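{- Let $p$ be a prime, $\ell>1$ an integer, $d=p^\ell-1$, $S=\mathbb{Z}/d\mathbb{Z}\setminus\{0,d/2\}$ if $d$ is even and $S=\mathbb{Z}/d\mathbb{Z}\setminus\{0\}$ if $d$ is odd, $S_f=\{a\in S\mid d/2<a<d\}$, $S_v=\{a\in S\mid 0<a<d/2\}$, and $\pi:S\to S$, $\pi(a)=pa$. Let $w$ be a word of length $\ell$ on the alphabet $\{f,v\}$. \begin{enumerate} \item If $w$ is primitive, then there is an element $a\in S$ with $w_a=w$. \item If $p>3$ (and $w$ is arbitrary, not necessarily primitive), then there is an element $a\in S$ with $w_a=w$. \end{enumerate}
   Context: Archimedean conditions on $a\in\mathbb{Z}/d\mathbb{Z}$ refer to its least positive residue. A word is primitive if it is not of the form $u^e$ for a word $u$ and an integer $e>1$. For $a\in S$ whose orbit under $\pi$ has size $\lambda$, the word $w_a=u_{\lambda-1}\cdots u_0$ is defined by $u_j=f$ if $\pi^j(a)\in S_f$ and $u_j=v$ if $\pi^j(a)\in S_v$. -}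

module Defs where

open import Data.Nat using (ℕ; zero; suc; _+_; _*_; _∸_; _^_; _<_; _≤_; _<ᵇ_)
open import Data.Nat.DivMod using (_%_)
open import Data.Bool using (if_then_else_)
open import Data.List using (List; []; _∷_; _++_; reverse; map; upTo; length)
open import Data.Product using (Σ; _×_; ∃-syntax)
open import Relation.Binary.PropositionalEquality using (_≡_; _≢_)
open import Relation.Nullary using (¬_)

data Letter : Set where
  f v : Letter

Word : Set
Word = List Letter

wpow : Word → ℕ → Word
wpow u zero = []
wpow u (suc e) = u ++ wpow u e

Primitive : Word → Set
Primitive w = ¬ (Σ Word λ u → Σ ℕ λ e → (1 < e) × (w ≡ wpow u e))

dOf : ℕ → ℕ → ℕ
dOf p ℓ = p ^ ℓ ∸ 1

-- reduction modulo d, elements of ℤ/dℤ represented by least residues in [0,d)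
-- (d > 0 in all uses; the zero case is a harmless convention)
modN : ℕ → ℕ → ℕ
modN a zero = a
modN a (suc n) = a % suc n

-- S = ℤ/dℤ \ {0, d/2} (d even), ℤ/dℤ \ {0} (d odd):
-- a residue a (0 ≤ a < d) with a ≠ 0 and 2a ≠ d (the latter is automatic for d odd)
InS : ℕ → ℕ → Set
InS d a = (a < d) × (a ≢ 0) × (2 * a ≢ d)

InSf : ℕ → ℕ → Set
InSf d a = InS d a × (d < 2 * a) × (a < d)

InSv : ℕ → ℕ → Set
InSv d a = InS d a × (0 < a) × (2 * a < d)

π : ℕ → ℕ → ℕ → ℕ
π p d a = modN (p * a) d

πiter : ℕ → ℕ → ℕ → ℕ → ℕ
πiter p d zero a = a
πiter p d (suc j) a = π p d (πiter p d j a)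

-- λ is the size of the orbit of a under π (π is a permutation of S,
-- so the orbit size is the least λ ≥ 1 with π^λ(a) = a)
OrbitSize : ℕ → ℕ → ℕ → ℕ → Set
OrbitSize p d a λ' = (1 ≤ λ') × (πiter p d λ' a ≡ a)
                   × ((k : ℕ) → 1 ≤ k → k < λ' → πiter p d k a ≢ a)

letterOf : ℕ → ℕ → Letter
letterOf d x = if d <ᵇ 2 * x then f else v

-- w_a = u_{λ-1} ⋯ u_0 with u_j the letter of π^j(a)
wordOf : ℕ → ℕ → ℕ → ℕ → Word
wordOf p d a λ' = reverse (map (λ j → letterOf d (πiter p d j a)) (upTo λ'))

Realized : ℕ → ℕ → Word → Set
Realized p ℓ w = Σ ℕ λ a → InS (dOf p ℓ) a ×
                   Σ ℕ λ λ' → OrbitSize p (dOf p ℓ) a λ' × (wordOf p (dOf p ℓ) a λ' ≡ w)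

{-# OPTIONS --safe #-}
module Submission where

-- Write a ∈ ℤ/dℤ in base p with ℓ digits. Since p ^ ℓ ≡ 1 (mod d), multiplication by p rotates the
-- digits cyclically, and a leading digit x with p ≤ 2x puts a in S_f while 2x + 2 ≤ p puts it in S_v.
-- So w is realised by the number whose digits, read along the orbit, encode the letters of w, as long
-- as no nontrivial rotation fixes the digit string: then the orbit has size exactly ℓ, and a is neither
-- 0 nor d, both of which the rotation fixes. Coding f and v by the digits p − 1 and 0 works when w is
-- primitive; for p > 3, marking the first letter by p − 2 or 1 instead works for every w.

open import Defs
open import Data.Nat
open import Data.Nat.Properties
open import Data.Nat.DivMod
open import Data.Nat.Primality using (Prime; prime⇒nonTrivial)
open import Data.Nat.Divisibility using (_∣_; ∣⇒≤; quotient>1)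
open import Data.Nat.GCD using (gcd; gcd-GCD; gcd[m,n]∣m; gcd[m,n]∣n; module Bézout)
open import Data.Nat.Tactic.RingSolver using (solve-∀)
open import Data.Bool using (true; false)
open import Data.Product using (Σ; _×_; _,_)
open import Data.Sum using ([_,_]′)
open import Data.List using (List; []; _∷_; _++_; map; upTo; applyUpTo; reverse; length)
open import Data.List.Properties using (reverse-++; ++-assoc; ++-identityʳ; reverse-involutive; length-reverse; map-upTo)
open import Relation.Binary.PropositionalEquality
open import Relation.Nullary using (¬_; contradiction)

HasPeriod : {A : Set} → (ℕ → A) → ℕ → Set
HasPeriod c k = ∀ t → c (t + k) ≡ c t

module _ {A : Set} {c : ℕ → A} where

  period-* : ∀ {k} → HasPeriod c k → ∀ q t → c (t + q * k) ≡ c t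
  period-* per zero    t = cong c (+-identityʳ t)
  period-* {k} per (suc q) t = begin
    c (t + (k + q * k)) ≡⟨ cong c (trans (cong (t +_) (+-comm k (q * k))) (sym (+-assoc t (q * k) k))) ⟩
    c (t + q * k + k)   ≡⟨ per (t + q * k) ⟩
    c (t + q * k)       ≡⟨ period-* per q t ⟩
    c t                 ∎
    where open ≡-Reasoning

  -- Bézout: one multiple of k and one of n differ by exactly gcd k n.
  period-gcd : ∀ {k n} → HasPeriod c k → HasPeriod c n → HasPeriod c (gcd k n)
  period-gcd {k} {n} perk pern t with Bézout.identity (gcd-GCD k n)
  ... | Bézout.Identity.+- x y eq = begin
    c (t + gcd k n)           ≡⟨ period-* pern y (t + gcd k n) ⟨
    c (t + gcd k n + y * n)   ≡⟨ cong c (trans (+-assoc t (gcd k n) (y * n)) (cong (t +_) eq)) ⟩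
    c (t + x * k)             ≡⟨ period-* perk x t ⟩
    c t                       ∎
    where open ≡-Reasoning
  ... | Bézout.Identity.-+ x y eq = begin
    c (t + gcd k n)           ≡⟨ period-* perk x (t + gcd k n) ⟨
    c (t + gcd k n + x * k)   ≡⟨ cong c (trans (+-assoc t (gcd k n) (x * k)) (cong (t +_) eq)) ⟩
    c (t + y * n)             ≡⟨ period-* pern y t ⟩
    c t                       ∎
    where open ≡-Reasoning

applyUpTo-cong : ∀ {A : Set} {φ ψ : ℕ → A} n → (∀ i → i < n → φ i ≡ ψ i) → applyUpTo φ n ≡ applyUpTo ψ n
applyUpTo-cong zero    eq = refl
applyUpTo-cong (suc n) eq = cong₂ _∷_ (eq 0 z<s) (applyUpTo-cong n (λ i i<n → eq (suc i) (s<s i<n)))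

applyUpTo-+ : ∀ {A : Set} (φ : ℕ → A) m n → applyUpTo φ (m + n) ≡ applyUpTo φ m ++ applyUpTo (λ i → φ (m + i)) n
applyUpTo-+ φ zero    n = refl
applyUpTo-+ φ (suc m) n = cong (φ 0 ∷_) (applyUpTo-+ (λ i → φ (suc i)) m n)

applyUpTo-periodic : ∀ {c : ℕ → Letter} {s} → HasPeriod c s → ∀ e →
                     applyUpTo c (e * s) ≡ wpow (applyUpTo c s) e
applyUpTo-periodic             per zero    = refl
applyUpTo-periodic {c = c} {s} per (suc e) = begin
  applyUpTo c (s + e * s)
    ≡⟨ applyUpTo-+ c s (e * s) ⟩
  applyUpTo c s ++ applyUpTo (λ i → c (s + i)) (e * s)
    ≡⟨ cong (applyUpTo c s ++_) (applyUpTo-cong (e * s) λ i _ → trans (cong c (+-comm s i)) (per i)) ⟩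
  applyUpTo c s ++ applyUpTo c (e * s)
    ≡⟨ cong (applyUpTo c s ++_) (applyUpTo-periodic per e) ⟩
  applyUpTo c s ++ wpow (applyUpTo c s) e ∎
  where open ≡-Reasoning

-- Out of range the letter is an arbitrary default.
letterAt : Word → ℕ → Letter
letterAt []       _       = v
letterAt (x ∷ xs) zero    = x
letterAt (x ∷ xs) (suc i) = letterAt xs i

applyUpTo-letterAt : ∀ xs → applyUpTo (letterAt xs) (length xs) ≡ xs
applyUpTo-letterAt []       = refl
applyUpTo-letterAt (x ∷ xs) = cong (x ∷_) (applyUpTo-letterAt xs)

wpow-++-comm : ∀ (u : Word) e → wpow u e ++ u ≡ u ++ wpow u e
wpow-++-comm u zero    = sym (++-identityʳ u)
wpow-++-comm u (suc e) = trans (++-assoc u (wpow u e) u) (cong (u ++_) (wpow-++-comm u e))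

reverse-wpow : ∀ (u : Word) e → reverse (wpow u e) ≡ wpow (reverse u) e
reverse-wpow u zero    = refl
reverse-wpow u (suc e) = begin
  reverse (u ++ wpow u e)              ≡⟨ reverse-++ u (wpow u e) ⟩
  reverse (wpow u e) ++ reverse u      ≡⟨ cong (_++ reverse u) (reverse-wpow u e) ⟩
  wpow (reverse u) e ++ reverse u      ≡⟨ wpow-++-comm (reverse u) e ⟩
  reverse u ++ wpow (reverse u) e      ∎
  where open ≡-Reasoning

ProperPower : Word → Set
ProperPower w = Σ Word λ u → Σ ℕ λ e → (1 < e) × (w ≡ wpow u e)

reverse-properPower : ∀ w → ProperPower (reverse w) → ProperPower w
reverse-properPower w (u , e , 1<e , eq) =
  reverse u , e , 1<e , trans (sym (reverse-involutive w)) (trans (cong reverse eq) (reverse-wpow u e))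

-- The cyclic extension of the letters has periods k and n, hence the period gcd k n, a proper divisor of n.
rotation-invariant⇒properPower : ∀ (xs : Word) n .{{_ : NonZero n}} → length xs ≡ n → ∀ k → 0 < k → k < n →
  (∀ t → t < n → letterAt xs ((k + t) % n) ≡ letterAt xs t) → ProperPower xs
rotation-invariant⇒properPower xs n refl k 0<k k<n inv =
  applyUpTo c s , e , quotient>1 s∣n s<n , (begin
    xs                        ≡⟨ applyUpTo-letterAt xs ⟨
    applyUpTo (letterAt xs) n ≡⟨ applyUpTo-cong n (λ i i<n → cong (letterAt xs) (sym (m<n⇒m%n≡m i<n))) ⟩
    applyUpTo c n             ≡⟨ cong (applyUpTo c) (_∣_.equality s∣n) ⟩
    applyUpTo c (e * s)       ≡⟨ applyUpTo-periodic (period-gcd c-period-k c-period-n) e ⟩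
    wpow (applyUpTo c s) e    ∎)
  where
    open ≡-Reasoning
    c : ℕ → Letter
    c i = letterAt xs (i % n)
    s : ℕ
    s = gcd k n
    s∣n : s ∣ n
    s∣n = gcd[m,n]∣n k n
    e : ℕ
    e = _∣_.quotient s∣n
    s<n : s < n
    s<n = ≤-<-trans (∣⇒≤ {{>-nonZero 0<k}} (gcd[m,n]∣m k n)) k<n
    c-period-n : HasPeriod c n
    c-period-n t = cong (letterAt xs) ([m+n]%n≡m%n t n)
    c-period-k : HasPeriod c k
    c-period-k t = begin
      letterAt xs ((t + k) % n)                      ≡⟨ cong (λ x → letterAt xs (x % n)) t+k≡ ⟩
      letterAt xs ((k + t % n + (t / n) * n) % n)    ≡⟨ cong (letterAt xs) ([m+kn]%n≡m%n (k + t % n) (t / n) n) ⟩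
      letterAt xs ((k + t % n) % n)                  ≡⟨ inv (t % n) (m%n<n t n) ⟩
      letterAt xs (t % n)                            ∎
      where
        t+k≡ : t + k ≡ k + t % n + (t / n) * n
        t+k≡ = begin
          t + k                      ≡⟨ +-comm t k ⟩
          k + t                      ≡⟨ cong (k +_) (m≡m%n+[m/n]*n t n) ⟩
          k + (t % n + (t / n) * n)  ≡⟨ +-assoc k (t % n) _ ⟨
          k + t % n + (t / n) * n    ∎

DigitFor : ℕ → Letter → ℕ → Set
DigitFor p f x = p ≤ 2 * x
DigitFor p v x = 2 * x + 2 ≤ p

letterOf-f : ∀ {d x} → d < 2 * x → letterOf d x ≡ f
letterOf-f {d} {x} d<2x with d <ᵇ 2 * x | <⇒<ᵇ d<2x
... | true  | _  = refl
... | false | ()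

letterOf-v : ∀ {d x} → 2 * x < d → letterOf d x ≡ v
letterOf-v {d} {x} 2x<d with d <ᵇ 2 * x | <ᵇ⇒< d (2 * x)
... | true  | d<2x = contradiction (d<2x _) (<-asym 2x<d)
... | false | _    = refl

modN-+* : ∀ {d} y x → y < d → modN (y + x * d) d ≡ y
modN-+* {suc d} y x y<d = trans ([m+kn]%n≡m%n y x (suc d)) (m<n⇒m%n≡m y<d)

-- δ 0, …, δ (ℓ ∸ 1) are the base-p digits of a = number 0 ℓ, most significant first; number j ℓ has them
-- rotated by j places, and turns out to be π^j(a), whose leading digit is δ j.
module CyclicNumber (p : ℕ) .{{_ : NonZero p}} (m : ℕ) (δ : ℕ → ℕ) (δ<p : ∀ r → r < suc m → δ r < p) where

  ℓ : ℕ
  ℓ = suc m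

  d : ℕ
  d = dOf p ℓ

  digit : ℕ → ℕ
  digit i = δ (i % ℓ)

  digit<p : ∀ i → digit i < p
  digit<p i = δ<p (i % ℓ) (m%n<n i ℓ)

  digit-periodic : HasPeriod digit ℓ
  digit-periodic i = cong δ ([m+n]%n≡m%n i ℓ)

  digit-small : ∀ {i} → i < ℓ → digit i ≡ δ i
  digit-small i<ℓ = cong δ (m<n⇒m%n≡m i<ℓ)

  number : ℕ → ℕ → ℕ
  number j zero    = 0
  number j (suc n) = number j n * p + digit (j + n)

  1+d≡p^ℓ : 1 + d ≡ p ^ ℓ
  1+d≡p^ℓ = m+[n∸m]≡n (m^n>0 p ℓ)

  number<p^n : ∀ j n → number j n < p ^ n
  number<p^n j zero    = s≤s z≤n
  number<p^n j (suc n) = begin-strict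
    number j n * p + digit (j + n) <⟨ +-monoʳ-< (number j n * p) (digit<p (j + n)) ⟩
    number j n * p + p             ≡⟨ +-comm (number j n * p) p ⟩
    suc (number j n) * p           ≤⟨ *-monoˡ-≤ p (number<p^n j n) ⟩
    p ^ n * p                      ≡⟨ *-comm (p ^ n) p ⟩
    p ^ suc n                      ∎
    where open ≤-Reasoning

  number≤d : ∀ j → number j ℓ ≤ d
  number≤d j = ≤-pred (subst (number j ℓ <_) (sym 1+d≡p^ℓ) (number<p^n j ℓ))

  number-leading : ∀ j n → number j (suc n) ≡ digit j * p ^ n + number (suc j) n
  number-leading j zero    = trans (cong digit (+-identityʳ j)) (sym (trans (+-identityʳ _) (*-identityʳ (digit j))))
  number-leading j (suc n) = begin
    number j (suc n) * p + digit (j + suc n)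
      ≡⟨ cong₂ (λ x y → x * p + digit y) (number-leading j n) (+-suc j n) ⟩
    (digit j * p ^ n + number (suc j) n) * p + digit (suc j + n)
      ≡⟨ distribute (digit j) (p ^ n) (number (suc j) n) p (digit (suc j + n)) ⟩
    digit j * (p * p ^ n) + (number (suc j) n * p + digit (suc j + n)) ∎
    where
      open ≡-Reasoning
      distribute : ∀ x y z q r → (x * y + z) * q + r ≡ x * (q * y) + (z * q + r)
      distribute = solve-∀

  number-rotate : ∀ j → p * number j ℓ ≡ number (suc j) ℓ + digit j * d
  number-rotate j = begin
    p * number j ℓ                                     ≡⟨ cong (p *_) (number-leading j m) ⟩
    p * (digit j * p ^ m + number (suc j) m)           ≡⟨ expand p (digit j) (p ^ m) (number (suc j) m) ⟩
    digit j * p ^ ℓ + number (suc j) m * p             ≡⟨ cong (λ P → digit j * P + number (suc j) m * p) 1+d≡p^ℓ ⟨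
    digit j * (1 + d) + number (suc j) m * p           ≡⟨ regroup (digit j) d (number (suc j) m * p) ⟩
    number (suc j) m * p + digit j + digit j * d       ≡⟨ cong (λ x → number (suc j) m * p + x + digit j * d) last-digit ⟨
    number (suc j) ℓ + digit j * d                     ∎
    where
      open ≡-Reasoning
      expand : ∀ q x y z → q * (x * y + z) ≡ x * (q * y) + z * q
      expand = solve-∀
      regroup : ∀ x y z → x * (1 + y) + z ≡ z + x + x * y
      regroup = solve-∀
      last-digit : digit (suc j + m) ≡ digit j
      last-digit = trans (cong digit (sym (+-suc j m))) (digit-periodic j)

  leading-f : ∀ j → p ≤ 2 * digit j → d < 2 * number j ℓ
  leading-f j p≤2g = begin-strict
    d                                          <⟨ ≤-reflexive 1+d≡p^ℓ ⟩
    p * p ^ m                                  ≤⟨ *-monoˡ-≤ (p ^ m) p≤2g ⟩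
    2 * digit j * p ^ m                        ≤⟨ m≤m+n (2 * digit j * p ^ m) (2 * number (suc j) m) ⟩
    2 * digit j * p ^ m + 2 * number (suc j) m ≡⟨ double (digit j) (p ^ m) (number (suc j) m) ⟩
    2 * (digit j * p ^ m + number (suc j) m)   ≡⟨ cong (2 *_) (number-leading j m) ⟨
    2 * number j ℓ                             ∎
    where
      open ≤-Reasoning
      double : ∀ x y z → 2 * x * y + 2 * z ≡ 2 * (x * y + z)
      double = solve-∀

  leading-v : ∀ j → 2 * digit j + 2 ≤ p → 2 * number j ℓ < d
  leading-v j 2g+2≤p = ≤-pred (begin
    suc (suc (2 * number j ℓ))                       ≡⟨ cong (λ x → 2 + 2 * x) (number-leading j m) ⟩
    2 + 2 * (digit j * p ^ m + number (suc j) m)     ≡⟨ double (digit j) (p ^ m) (number (suc j) m) ⟩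
    2 * digit j * p ^ m + 2 * suc (number (suc j) m) ≤⟨ +-monoʳ-≤ (2 * digit j * p ^ m) (*-monoʳ-≤ 2 (number<p^n (suc j) m)) ⟩
    2 * digit j * p ^ m + 2 * p ^ m                  ≡⟨ *-distribʳ-+ (p ^ m) (2 * digit j) 2 ⟨
    (2 * digit j + 2) * p ^ m                        ≤⟨ *-monoˡ-≤ (p ^ m) 2g+2≤p ⟩
    p * p ^ m                                        ≡⟨ 1+d≡p^ℓ ⟨
    suc d                                            ∎)
    where
      open ≤-Reasoning
      double : ∀ x y z → 2 + 2 * (x * y + z) ≡ 2 * x * y + 2 * (1 + z)
      double = solve-∀

  letterOf-number : ∀ {L} j → DigitFor p L (digit j) → letterOf d (number j ℓ) ≡ L
  letterOf-number {f} j fits = letterOf-f {x = number j ℓ} (leading-f j fits)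
  letterOf-number {v} j fits = letterOf-v {x = number j ℓ} (leading-v j fits)

  2*number≢d : ∀ {L} j → DigitFor p L (digit j) → 2 * number j ℓ ≢ d
  2*number≢d {f} j fits eq = <-irrefl (sym eq) (leading-f j fits)
  2*number≢d {v} j fits eq = <-irrefl eq (leading-v j fits)

  number-last-digit : ∀ j n → number j (suc n) % p ≡ digit (j + n)
  number-last-digit j n = begin
    (number j n * p + digit (j + n)) % p ≡⟨ cong (_% p) (+-comm (number j n * p) (digit (j + n))) ⟩
    (digit (j + n) + number j n * p) % p ≡⟨ [m+kn]%n≡m%n (digit (j + n)) (number j n) p ⟩
    digit (j + n) % p                    ≡⟨ m<n⇒m%n≡m (digit<p (j + n)) ⟩
    digit (j + n)                        ∎
    where open ≡-Reasoning

  number-injective : ∀ n i j → number i n ≡ number j n → ∀ t → t < n → digit (i + t) ≡ digit (j + t)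
  number-injective (suc n) i j eq t t<1+n =
    [ number-injective n i j init-equal t , (λ { refl → last-equal }) ]′ (m<1+n⇒m<n∨m≡n t<1+n)
    where
      last-equal : digit (i + n) ≡ digit (j + n)
      last-equal = trans (sym (number-last-digit i n)) (trans (cong (_% p) eq) (number-last-digit j n))
      init-equal : number i n ≡ number j n
      init-equal = *-cancelʳ-≡ (number i n) (number j n) p
        (+-cancelʳ-≡ (digit (i + n)) _ _ (trans eq (cong (number j n * p +_) (sym last-equal))))

  number-cong : ∀ {i j} → (∀ t → digit (i + t) ≡ digit (j + t)) → ∀ n → number i n ≡ number j n
  number-cong same zero    = refl
  number-cong same (suc n) = cong₂ (λ x y → x * p + y) (number-cong same n) (same n)

  number-periodic : ∀ q j n → number (j + q * ℓ) n ≡ number j n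
  number-periodic q j = number-cong λ t →
    trans (cong digit (shuffle j (q * ℓ) t)) (period-* digit-periodic q (j + t))
    where
      shuffle : ∀ x y z → x + y + z ≡ x + z + y
      shuffle = solve-∀

  number-0-step : ∀ j → number j ℓ ≡ 0 → number (suc j) ℓ ≡ 0
  number-0-step j N≡0 = m+n≡0⇒m≡0 (number (suc j) ℓ) (begin
    number (suc j) ℓ + digit j * d ≡⟨ number-rotate j ⟨
    p * number j ℓ                 ≡⟨ cong (p *_) N≡0 ⟩
    p * 0                          ≡⟨ *-zeroʳ p ⟩
    0                              ∎)
    where open ≡-Reasoning

  number-d-step : ∀ j → number j ℓ ≡ d → number (suc j) ℓ ≡ d
  number-d-step j N≡d = ≤-antisym (number≤d (suc j)) (+-cancelʳ-≤ (digit j * d) d _ (begin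
    d + digit j * d                ≤⟨ *-monoˡ-≤ d (digit<p j) ⟩
    p * d                          ≡⟨ cong (p *_) N≡d ⟨
    p * number j ℓ                 ≡⟨ number-rotate j ⟩
    number (suc j) ℓ + digit j * d ∎))
    where open ≤-Reasoning

  module _ (1<ℓ : 1 < ℓ) (aperiodic : ∀ k → 0 < k → k < ℓ → ¬ (∀ t → t < ℓ → δ ((k + t) % ℓ) ≡ δ t)) where

    number-rotations-distinct : ∀ k → 0 < k → k < ℓ → number k ℓ ≢ number 0 ℓ
    number-rotations-distinct k 0<k k<ℓ eq =
      aperiodic k 0<k k<ℓ λ t t<ℓ → trans (number-injective ℓ k 0 eq t t<ℓ) (digit-small t<ℓ)

    -- A rotation stuck at x forces number 0 ℓ ≡ number 1 ℓ ≡ x, a period 1 of the digits.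
    number-avoids-fixed : ∀ x → (∀ j → number j ℓ ≡ x → number (suc j) ℓ ≡ x) → ∀ j → number j ℓ ≢ x
    number-avoids-fixed x step j Nj≡x = number-rotations-distinct 1 z<s 1<ℓ (trans (stays 1 N0≡x) (sym N0≡x))
      where
        stays : ∀ i {k} → number k ℓ ≡ x → number (i + k) ℓ ≡ x
        stays zero    eq = eq
        stays (suc i) eq = step _ (stays i eq)
        N0≡x : number 0 ℓ ≡ x
        N0≡x = begin
          number 0 ℓ           ≡⟨ number-periodic j 0 ℓ ⟨
          number (j * ℓ) ℓ     ≡⟨ cong (λ i → number i ℓ) (trans (*-suc j m) (+-comm j (j * m))) ⟩
          number (j * m + j) ℓ ≡⟨ stays (j * m) Nj≡x ⟩
          x                    ∎
          where open ≡-Reasoning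

    number≢0 : ∀ j → number j ℓ ≢ 0
    number≢0 = number-avoids-fixed 0 number-0-step

    number<d : ∀ j → number j ℓ < d
    number<d j = ≤∧≢⇒< (number≤d j) (number-avoids-fixed d number-d-step j)

    πiter-number : ∀ j → πiter p d j (number 0 ℓ) ≡ number j ℓ
    πiter-number zero    = refl
    πiter-number (suc j) = begin
      modN (p * πiter p d j (number 0 ℓ)) d   ≡⟨ cong (λ x → modN (p * x) d) (πiter-number j) ⟩
      modN (p * number j ℓ) d                 ≡⟨ cong (λ x → modN x d) (number-rotate j) ⟩
      modN (number (suc j) ℓ + digit j * d) d ≡⟨ modN-+* (number (suc j) ℓ) (digit j) (number<d (suc j)) ⟩
      number (suc j) ℓ                        ∎
      where open ≡-Reasoning

    orbitSize : OrbitSize p d (number 0 ℓ) ℓ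
    orbitSize =
      s≤s z≤n ,
      trans (πiter-number ℓ) (trans (cong (λ i → number i ℓ) (sym (*-identityˡ ℓ))) (number-periodic 1 0 ℓ)) ,
      λ k 0<k k<ℓ eq → number-rotations-distinct k 0<k k<ℓ (trans (sym (πiter-number k)) eq)

    realize : (w : Word) → length w ≡ ℓ → (∀ i → i < ℓ → DigitFor p (letterAt (reverse w) i) (δ i)) → Realized p ℓ w
    realize w ∣w∣≡ℓ fits =
      number 0 ℓ , (number<d 0 , number≢0 0 , 2*number≢d 0 (fits′ 0 z<s)) , ℓ , orbitSize , reads-w
      where
        fits′ : ∀ i → i < ℓ → DigitFor p (letterAt (reverse w) i) (digit i)
        fits′ i i<ℓ = subst (DigitFor p _) (sym (digit-small i<ℓ)) (fits i i<ℓ)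
        reads-w : wordOf p d (number 0 ℓ) ℓ ≡ w
        reads-w = begin
          reverse (map (λ j → letterOf d (πiter p d j (number 0 ℓ))) (upTo ℓ))
            ≡⟨ cong reverse (map-upTo _ ℓ) ⟩
          reverse (applyUpTo (λ j → letterOf d (πiter p d j (number 0 ℓ))) ℓ)
            ≡⟨ cong reverse (applyUpTo-cong ℓ λ j j<ℓ →
                 trans (cong (letterOf d) (πiter-number j)) (letterOf-number j (fits′ j j<ℓ))) ⟩
          reverse (applyUpTo (letterAt (reverse w)) ℓ)
            ≡⟨ cong (λ n → reverse (applyUpTo (letterAt (reverse w)) n)) (trans (length-reverse w) ∣w∣≡ℓ) ⟨
          reverse (applyUpTo (letterAt (reverse w)) (length (reverse w)))
            ≡⟨ cong reverse (applyUpTo-letterAt (reverse w)) ⟩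
          reverse (reverse w)
            ≡⟨ reverse-involutive w ⟩
          w ∎
          where open ≡-Reasoning

digitFor : ℕ → Letter → ℕ
digitFor p f = p ∸ 1
digitFor p v = 0

markedDigitFor : ℕ → Letter → ℕ
markedDigitFor p f = p ∸ 2
markedDigitFor p v = 1

k+k+q≤2*[k+q] : ∀ k q → k + k + q ≤ 2 * (k + q)
k+k+q≤2*[k+q] k q = ≤-trans (+-monoʳ-≤ (k + k) (m≤m+n q q)) (≤-reflexive (regroup k q))
  where
    regroup : ∀ k q → k + k + (q + q) ≡ 2 * (k + q)
    regroup = solve-∀

digitFor<p : ∀ {p} → 2 ≤ p → ∀ x → digitFor p x < p
digitFor<p {2+ q} (s≤s (s≤s z≤n)) f = n<1+n (suc q)
digitFor<p {2+ q} (s≤s (s≤s z≤n)) v = z<s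

digitFor-fits : ∀ {p} → 2 ≤ p → ∀ x → DigitFor p x (digitFor p x)
digitFor-fits 2≤p                     v = 2≤p
digitFor-fits {2+ q} (s≤s (s≤s z≤n)) f = k+k+q≤2*[k+q] 1 q

digitFor-injective : ∀ {p} → 2 ≤ p → ∀ x y → digitFor p x ≡ digitFor p y → x ≡ y
digitFor-injective _                     f f _  = refl
digitFor-injective _                     v v _  = refl
digitFor-injective {2+ q} (s≤s (s≤s z≤n)) f v ()
digitFor-injective {2+ q} (s≤s (s≤s z≤n)) v f ()

markedDigitFor<p : ∀ {p} → 4 ≤ p → ∀ x → markedDigitFor p x < p
markedDigitFor<p {2+ (2+ q)} (s≤s (s≤s (s≤s (s≤s z≤n)))) f = ≤-trans (n<1+n (2 + q)) (n≤1+n (3 + q))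
markedDigitFor<p {2+ (2+ q)} (s≤s (s≤s (s≤s (s≤s z≤n)))) v = s≤s z<s

markedDigitFor-fits : ∀ {p} → 4 ≤ p → ∀ x → DigitFor p x (markedDigitFor p x)
markedDigitFor-fits 4≤p                                      v = 4≤p
markedDigitFor-fits {2+ (2+ q)} (s≤s (s≤s (s≤s (s≤s z≤n)))) f = k+k+q≤2*[k+q] 2 q

markedDigitFor≢digitFor : ∀ {p} → 4 ≤ p → ∀ x y → markedDigitFor p x ≢ digitFor p y
markedDigitFor≢digitFor {2+ (2+ q)} (s≤s (s≤s (s≤s (s≤s z≤n)))) f f eq = <-irrefl eq (n<1+n (2 + q))
markedDigitFor≢digitFor {2+ (2+ q)} (s≤s (s≤s (s≤s (s≤s z≤n)))) f v ()
markedDigitFor≢digitFor {2+ (2+ q)} (s≤s (s≤s (s≤s (s≤s z≤n)))) v f ()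
markedDigitFor≢digitFor {2+ (2+ q)} (s≤s (s≤s (s≤s (s≤s z≤n)))) v v ()

-- A rotation of the digits is a rotation of reverse w, which would make w a proper power.
primitive⇒realized : ∀ p m → 2 ≤ p → 1 < suc m → (w : Word) → length w ≡ suc m → Primitive w → Realized p (suc m) w
primitive⇒realized p m 2≤p 1<ℓ w ∣w∣≡ℓ w-primitive =
  CyclicNumber.realize p {{>-nonZero (<-≤-trans z<s 2≤p)}} m δ (λ r _ → digitFor<p 2≤p (letterAt rw r))
    1<ℓ aperiodic w ∣w∣≡ℓ (λ i _ → digitFor-fits 2≤p (letterAt rw i))
  where
    rw : Word
    rw = reverse w
    δ : ℕ → ℕ
    δ i = digitFor p (letterAt rw i)
    aperiodic : ∀ k → 0 < k → k < suc m → ¬ (∀ t → t < suc m → δ ((k + t) % suc m) ≡ δ t)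
    aperiodic k 0<k k<ℓ invariant = w-primitive (reverse-properPower w
      (rotation-invariant⇒properPower rw (suc m) (trans (length-reverse w) ∣w∣≡ℓ) k 0<k k<ℓ
        λ t t<ℓ → digitFor-injective 2≤p _ _ (invariant t t<ℓ)))

-- The marked digit in position 0 occurs nowhere else, so no rotation preserves the digits.
marked⇒realized : ∀ p m → 4 ≤ p → 1 < suc m → (w : Word) → length w ≡ suc m → Realized p (suc m) w
marked⇒realized p m 4≤p 1<ℓ w ∣w∣≡ℓ =
  CyclicNumber.realize p {{>-nonZero (<-≤-trans z<s 4≤p)}} m δ δ<p 1<ℓ aperiodic w ∣w∣≡ℓ fits
  where
    rw : Word
    rw = reverse w
    2≤p : 2 ≤ p
    2≤p = ≤-trans (s≤s (s≤s z≤n)) 4≤p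
    δ : ℕ → ℕ
    δ zero    = markedDigitFor p (letterAt rw 0)
    δ (suc i) = digitFor p (letterAt rw (suc i))
    δ<p : ∀ r → r < suc m → δ r < p
    δ<p zero    _ = markedDigitFor<p 4≤p (letterAt rw 0)
    δ<p (suc r) _ = digitFor<p 2≤p (letterAt rw (suc r))
    fits : ∀ i → i < suc m → DigitFor p (letterAt rw i) (δ i)
    fits zero    _ = markedDigitFor-fits 4≤p (letterAt rw 0)
    fits (suc i) _ = digitFor-fits 2≤p (letterAt rw (suc i))
    aperiodic : ∀ k → 0 < k → k < suc m → ¬ (∀ t → t < suc m → δ ((k + t) % suc m) ≡ δ t)
    aperiodic k 0<k (s≤s k≤m) invariant =
      markedDigitFor≢digitFor 4≤p (letterAt rw 0) (letterAt rw (suc (m ∸ k)))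
        (trans (cong δ (sym wraps-to-0)) (invariant (suc (m ∸ k)) (s≤s (∸-monoʳ-< 0<k k≤m))))
      where
        wraps-to-0 : (k + suc (m ∸ k)) % suc m ≡ 0
        wraps-to-0 = trans (cong (_% suc m) (trans (+-suc k (m ∸ k)) (cong suc (m+[n∸m]≡n k≤m)))) (n%n≡0 (suc m))

proposition6p1 : (p ℓ : ℕ) → Prime p → 1 < ℓ → (w : Word) → length w ≡ ℓ →
                   (Primitive w → Realized p ℓ w) × (3 < p → Realized p ℓ w)
proposition6p1 p (suc m) p-prime 1<ℓ w ∣w∣≡ℓ =
  primitive⇒realized p m 2≤p 1<ℓ w ∣w∣≡ℓ , λ 3<p → marked⇒realized p m 3<p 1<ℓ w ∣w∣≡ℓ
  where
    2≤p : 2 ≤ p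
    2≤p = nonTrivial⇒n>1 p {{prime⇒nonTrivial p-prime}}
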